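{- Let $G$ be a graph and let $u$ be a vertex that is non-avoidable in $G$. Then $u$ is avoidable in the complement $\overline{G}$.
   Context: All graphs are finite, simple and undirected. A vertex $v$ of a graph $G$ is avoidable if every induced path on three vertices with middle vertex $v$ is contained in an induced cycle of $G$; equivalently, $d_G(v)\le1$ or for every pair $x,y\in N_G(v)$, $x$ and $y$ lie in the same connected component of $G-(N_G[v]\setminus\{x,y\})$. $\overline{G}$ denotes the complement of $G$. -}

module Defs where

open import Data.Nat using (ℕ; suc; _+_; _<_; _≤_)
open import Data.Fin using (Fin; toℕ)
open import Data.Vec using (Vec; lookup)
open import Data.Product using (Σ; ∃; _×_; _,_)
open import Data.Sum using (_⊎_)
open import Relation.Nullary using (¬_; Dec; _×-dec_; ¬?)
open import Data.Fin.Properties using (_≟_)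
open import Relation.Binary.PropositionalEquality using (_≡_; _≢_) renaming (sym to ≡-sym)

record Graph (n : ℕ) : Set₁ where
  field
    Adj     : Fin n → Fin n → Set
    irrefl  : ∀ {x} → ¬ Adj x x
    sym     : ∀ {x y} → Adj x y → Adj y x
    adj?    : ∀ x y → Dec (Adj x y)

open Graph public

complement : ∀ {n} → Graph n → Graph n
complement G = record
  { Adj    = λ x y → (x ≢ y) × ¬ Adj G x y
  ; irrefl = λ { (x≢x , _) → x≢x _≡_.refl }
  ; sym    = λ { (x≢y , ¬xy) → (λ e → x≢y (≡-sym e)) , λ yx → ¬xy (Graph.sym G yx) }
  ; adj?   = λ x y → ¬? (x ≟ y) ×-dec ¬? (adj? G x y)
  }

CycAdjIdx : ∀ {k} → Fin k → Fin k → Set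
CycAdjIdx {k} i j =
  (suc (toℕ i) ≡ toℕ j) ⊎ (suc (toℕ j) ≡ toℕ i)
  ⊎ ((toℕ i ≡ 0 × suc (toℕ j) ≡ k) ⊎ (toℕ j ≡ 0 × suc (toℕ i) ≡ k))

record InducedCycle {n} (G : Graph n) (k : ℕ) : Set where
  field
    len≥3    : 3 ≤ k
    vert     : Vec (Fin n) k
    distinct : ∀ i j → lookup vert i ≡ lookup vert j → i ≡ j
    adj→cyc  : ∀ i j → Adj G (lookup vert i) (lookup vert j) → CycAdjIdx i j
    cyc→adj  : ∀ i j → CycAdjIdx i j → Adj G (lookup vert i) (lookup vert j)

P3InInducedCycle : ∀ {n} → Graph n → Fin n → Fin n → Fin n → Set
P3InInducedCycle G x v y =
  Σ ℕ λ k → Σ (InducedCycle G k) λ C →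
    let open InducedCycle C in
    Σ (Fin k) λ i → Σ (Fin k) λ j → Σ (Fin k) λ l →
      CycAdjIdx i j × CycAdjIdx j l × i ≢ l ×
      lookup vert i ≡ x × lookup vert j ≡ v × lookup vert l ≡ y

Avoidable : ∀ {n} → Graph n → Fin n → Set
Avoidable G v =
  ∀ x y → Adj G x v → Adj G v y → x ≢ y → ¬ Adj G x y →
    P3InInducedCycle G x v y

-- If some G-neighbour a of u is adjacent to neither x nor y, then u x a y is an
-- induced C4 of the complement. Otherwise the edge xy of G (x and y are
-- non-adjacent in the complement) dominates the neighbourhood of u, and every
-- induced path a u b of G closes through xy into an induced C4 or C5, so u would
-- be avoidable in G.
module Submission where

open import Defs
open import Data.Nat using (ℕ; suc; s≤s; z≤n)
open import Data.Fin using (Fin; zero; suc; toℕ; fromℕ)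
open import Data.Fin.Properties using (toℕ-fromℕ; any?)
open import Data.Vec using (Vec; lookup; _∷_; [])
open import Data.Vec.Relation.Unary.All using (All; _∷_; [])
open import Data.Vec.Relation.Unary.All.Properties using (lookup⁺)
open import Data.Product using (_×_; _,_; proj₁; proj₂)
open import Data.Sum using (_⊎_; inj₁; inj₂) renaming (map to map-⊎)
open import Data.Empty using (⊥-elim)
open import Relation.Nullary using (¬_; yes; no; _×-dec_; ¬?)
open import Relation.Nullary.Decidable using (decidable-stable)
open import Relation.Binary.PropositionalEquality using (_≡_; _≢_; refl; cong) renaming (sym to ≡-sym)
import Data.Nat.Properties as ℕ

CycAdjIdx-sym : ∀ {k} {i j : Fin k} → CycAdjIdx i j → CycAdjIdx j i
CycAdjIdx-sym (inj₁ e)              = inj₂ (inj₁ e)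
CycAdjIdx-sym (inj₂ (inj₁ e))       = inj₁ e
CycAdjIdx-sym (inj₂ (inj₂ (inj₁ w))) = inj₂ (inj₂ (inj₂ w))
CycAdjIdx-sym (inj₂ (inj₂ (inj₂ w))) = inj₂ (inj₂ (inj₁ w))

CycAdjIdx-suc : ∀ {k} {i j : Fin k} → CycAdjIdx (suc i) (suc j) →
                suc (toℕ i) ≡ toℕ j ⊎ suc (toℕ j) ≡ toℕ i
CycAdjIdx-suc (inj₁ e)                   = inj₁ (ℕ.suc-injective e)
CycAdjIdx-suc (inj₂ (inj₁ e))            = inj₂ (ℕ.suc-injective e)
CycAdjIdx-suc (inj₂ (inj₂ (inj₁ (() , _))))
CycAdjIdx-suc (inj₂ (inj₂ (inj₂ (() , _))))

module _ {n} (G : Graph n) where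

  Apart : Fin n → Fin n → Set
  Apart a b = a ≢ b × ¬ Adj G a b

  adj⇒≢ : ∀ {a b} → Adj G a b → a ≢ b
  adj⇒≢ ab refl = irrefl G ab

  apart-sym : ∀ {a b} → Apart a b → Apart b a
  apart-sym (a≢b , ¬ab) = (λ e → a≢b (≡-sym e)) , (λ ba → ¬ab (Graph.sym G ba))

  data InducedPath : ∀ {m} → Vec (Fin n) (suc m) → Set where
    [_]  : ∀ x → InducedPath (x ∷ [])
    step : ∀ {m x y} {zs : Vec (Fin n) m} →
           Adj G x y → All (Apart x) zs → InducedPath (y ∷ zs) → InducedPath (x ∷ y ∷ zs)

  module _ {m x y} {zs : Vec (Fin n) m} (xy : Adj G x y) (x#zs : All (Apart x) zs) where

    step-head-≢ : ∀ j → x ≢ lookup (y ∷ zs) j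
    step-head-≢ zero    = adj⇒≢ xy
    step-head-≢ (suc j) = proj₁ (lookup⁺ x#zs j)

    step-head-adj : ∀ j → Adj G x (lookup (y ∷ zs) j) → toℕ j ≡ 0
    step-head-adj zero    _   = refl
    step-head-adj (suc j) xzj = ⊥-elim (proj₂ (lookup⁺ x#zs j) xzj)

  inducedPath-injective : ∀ {m} {ps : Vec (Fin n) (suc m)} → InducedPath ps →
                          ∀ i j → lookup ps i ≡ lookup ps j → i ≡ j
  inducedPath-injective [ x ]            zero    zero    _ = refl
  inducedPath-injective (step xy x#zs p) zero    zero    _ = refl
  inducedPath-injective (step xy x#zs p) zero    (suc j) e = ⊥-elim (step-head-≢ xy x#zs j e)
  inducedPath-injective (step xy x#zs p) (suc i) zero    e = ⊥-elim (step-head-≢ xy x#zs i (≡-sym e))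
  inducedPath-injective (step xy x#zs p) (suc i) (suc j) e = cong suc (inducedPath-injective p i j e)

  inducedPath-adj⇒consecutive : ∀ {m} {ps : Vec (Fin n) (suc m)} → InducedPath ps →
    ∀ i j → Adj G (lookup ps i) (lookup ps j) → suc (toℕ i) ≡ toℕ j ⊎ suc (toℕ j) ≡ toℕ i
  inducedPath-adj⇒consecutive [ x ]            zero    zero    a = ⊥-elim (irrefl G a)
  inducedPath-adj⇒consecutive (step xy x#zs p) zero    zero    a = ⊥-elim (irrefl G a)
  inducedPath-adj⇒consecutive (step xy x#zs p) zero    (suc j) a =
    inj₁ (cong suc (≡-sym (step-head-adj xy x#zs j a)))
  inducedPath-adj⇒consecutive (step xy x#zs p) (suc i) zero    a =
    inj₂ (cong suc (≡-sym (step-head-adj xy x#zs i (Graph.sym G a))))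
  inducedPath-adj⇒consecutive (step xy x#zs p) (suc i) (suc j) a =
    map-⊎ (cong suc) (cong suc) (inducedPath-adj⇒consecutive p i j a)

  inducedPath-consecutive⇒adj : ∀ {m} {ps : Vec (Fin n) (suc m)} → InducedPath ps →
    ∀ i j → suc (toℕ i) ≡ toℕ j → Adj G (lookup ps i) (lookup ps j)
  inducedPath-consecutive⇒adj (step xy x#zs p) zero    (suc zero)    _ = xy
  inducedPath-consecutive⇒adj (step xy x#zs p) (suc i) (suc j)       e =
    inducedPath-consecutive⇒adj p i j (ℕ.suc-injective e)

  data AdjacentOnlyToLast (v y : Fin n) : ∀ {m} → Vec (Fin n) (suc m) → Set where
    last : Adj G v y → AdjacentOnlyToLast v y (y ∷ [])
    _∷_  : ∀ {m z} {zs : Vec (Fin n) (suc m)} →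
           Apart v z → AdjacentOnlyToLast v y zs → AdjacentOnlyToLast v y (z ∷ zs)

  module _ {v y : Fin n} where

    adjacentOnlyToLast-lookup-last : ∀ {m} {zs : Vec (Fin n) (suc m)} →
      AdjacentOnlyToLast v y zs → lookup zs (fromℕ m) ≡ y
    adjacentOnlyToLast-lookup-last (last _)   = refl
    adjacentOnlyToLast-lookup-last (_ ∷ v#zs) = adjacentOnlyToLast-lookup-last v#zs

    adjacentOnlyToLast-≢ : ∀ {m} {zs : Vec (Fin n) (suc m)} →
      AdjacentOnlyToLast v y zs → ∀ j → v ≢ lookup zs j
    adjacentOnlyToLast-≢ (last vy)        zero    = adj⇒≢ vy
    adjacentOnlyToLast-≢ ((v≢z , _) ∷ _)  zero    = v≢z
    adjacentOnlyToLast-≢ (_ ∷ v#zs)       (suc j) = adjacentOnlyToLast-≢ v#zs j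

    adjacentOnlyToLast-adj⇒last : ∀ {m} {zs : Vec (Fin n) (suc m)} →
      AdjacentOnlyToLast v y zs → ∀ j → Adj G v (lookup zs j) → toℕ j ≡ m
    adjacentOnlyToLast-adj⇒last (last _)       zero    _  = refl
    adjacentOnlyToLast-adj⇒last ((_ , ¬vz) ∷ _) zero    vz = ⊥-elim (¬vz vz)
    adjacentOnlyToLast-adj⇒last (_ ∷ v#zs)      (suc j) vz =
      cong suc (adjacentOnlyToLast-adj⇒last v#zs j vz)

    adjacentOnlyToLast-last⇒adj : ∀ {m} {zs : Vec (Fin n) (suc m)} →
      AdjacentOnlyToLast v y zs → ∀ j → toℕ j ≡ m → Adj G v (lookup zs j)
    adjacentOnlyToLast-last⇒adj (last vy)  zero    _ = vy
    adjacentOnlyToLast-last⇒adj (_ ∷ v#zs) (suc j) e =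
      adjacentOnlyToLast-last⇒adj v#zs j (ℕ.suc-injective e)

  -- The induced cycle v x … y: v sits at position 0 and y at the last position.
  module ClosedInducedPath {m v x y} {zs : Vec (Fin n) (suc m)}
           (vx : Adj G v x) (path : InducedPath (x ∷ zs)) (v#zs : AdjacentOnlyToLast v y zs) where

    private
      k : ℕ
      k = suc (suc (suc m))

    closing-≢ : ∀ j → v ≢ lookup (x ∷ zs) j
    closing-≢ zero    = adj⇒≢ vx
    closing-≢ (suc j) = adjacentOnlyToLast-≢ v#zs j

    closing-adj⇒cyc : ∀ j → Adj G v (lookup (x ∷ zs) j) → CycAdjIdx {k} zero (suc j)
    closing-adj⇒cyc zero    _  = inj₁ refl
    closing-adj⇒cyc (suc j) vz =
      inj₂ (inj₂ (inj₁ (refl , cong (λ t → suc (suc (suc t))) (adjacentOnlyToLast-adj⇒last v#zs j vz))))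

    closing-cyc⇒adj : ∀ j → CycAdjIdx {k} zero (suc j) → Adj G v (lookup (x ∷ zs) j)
    closing-cyc⇒adj zero    _                           = vx
    closing-cyc⇒adj (suc j) (inj₁ ())
    closing-cyc⇒adj (suc j) (inj₂ (inj₁ ()))
    closing-cyc⇒adj (suc j) (inj₂ (inj₂ (inj₁ (_ , e)))) =
      adjacentOnlyToLast-last⇒adj v#zs j (ℕ.suc-injective (ℕ.suc-injective (ℕ.suc-injective e)))
    closing-cyc⇒adj (suc j) (inj₂ (inj₂ (inj₂ (() , _))))

    distinct : ∀ i j → lookup (v ∷ x ∷ zs) i ≡ lookup (v ∷ x ∷ zs) j → i ≡ j
    distinct zero    zero    _ = refl
    distinct zero    (suc j) e = ⊥-elim (closing-≢ j e)
    distinct (suc i) zero    e = ⊥-elim (closing-≢ i (≡-sym e))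
    distinct (suc i) (suc j) e = cong suc (inducedPath-injective path i j e)

    adj⇒cyc : ∀ i j → Adj G (lookup (v ∷ x ∷ zs) i) (lookup (v ∷ x ∷ zs) j) → CycAdjIdx i j
    adj⇒cyc zero    zero    a = ⊥-elim (irrefl G a)
    adj⇒cyc zero    (suc j) a = closing-adj⇒cyc j a
    adj⇒cyc (suc i) zero    a = CycAdjIdx-sym (closing-adj⇒cyc i (Graph.sym G a))
    adj⇒cyc (suc i) (suc j) a with inducedPath-adj⇒consecutive path i j a
    ... | inj₁ e = inj₁ (cong suc e)
    ... | inj₂ e = inj₂ (inj₁ (cong suc e))

    cyc⇒adj : ∀ i j → CycAdjIdx i j → Adj G (lookup (v ∷ x ∷ zs) i) (lookup (v ∷ x ∷ zs) j)
    cyc⇒adj zero    zero    (inj₁ ())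
    cyc⇒adj zero    zero    (inj₂ (inj₁ ()))
    cyc⇒adj zero    zero    (inj₂ (inj₂ (inj₁ (_ , ()))))
    cyc⇒adj zero    zero    (inj₂ (inj₂ (inj₂ (_ , ()))))
    cyc⇒adj zero    (suc j) c = closing-cyc⇒adj j c
    cyc⇒adj (suc i) zero    c = Graph.sym G (closing-cyc⇒adj i (CycAdjIdx-sym c))
    cyc⇒adj (suc i) (suc j) c with CycAdjIdx-suc c
    ... | inj₁ e = inducedPath-consecutive⇒adj path i j e
    ... | inj₂ e = Graph.sym G (inducedPath-consecutive⇒adj path j i e)

    cycle : InducedCycle G k
    cycle = record
      { len≥3    = s≤s (s≤s (s≤s z≤n))
      ; vert     = v ∷ x ∷ zs
      ; distinct = distinct
      ; adj→cyc  = adj⇒cyc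
      ; cyc→adj  = cyc⇒adj
      }

    p3InInducedCycle : P3InInducedCycle G x v y
    p3InInducedCycle =
      k , cycle , suc zero , zero , suc (suc (fromℕ m)) ,
      inj₂ (inj₁ refl) ,
      inj₂ (inj₂ (inj₁ (refl , cong (λ t → suc (suc (suc t))) (toℕ-fromℕ m)))) ,
      (λ ()) , refl , refl , adjacentOnlyToLast-lookup-last v#zs

  p3InInducedC4 : ∀ {v a w b} → Adj G v a → Adj G v b → Apart a b →
                  Adj G a w → Adj G w b → Apart v w → P3InInducedCycle G a v b
  p3InInducedC4 va vb a#b aw wb v#w =
    ClosedInducedPath.p3InInducedCycle va (step aw (a#b ∷ []) (step wb [] [ _ ])) (v#w ∷ last vb)

  p3InInducedC5 : ∀ {v a w z b} → Adj G v a → Adj G v b → Apart a b →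
                  Adj G a w → Adj G w z → Adj G z b → Apart a z → Apart w b →
                  Apart v w → Apart v z → P3InInducedCycle G a v b
  p3InInducedC5 va vb a#b aw wz zb a#z w#b v#w v#z =
    ClosedInducedPath.p3InInducedCycle va
      (step aw (a#z ∷ a#b ∷ []) (step wz (w#b ∷ []) (step zb [] [ _ ])))
      (v#w ∷ v#z ∷ last vb)

  dominatingEdge⇒avoidable : ∀ {u x y} → Adj G x y → ¬ Adj G x u → ¬ Adj G y u →
    (∀ a → Adj G u a → Adj G a x ⊎ Adj G a y) → Avoidable G u
  dominatingEdge⇒avoidable {u} {x} {y} xy ¬xu ¬yu cover a b au ub a≢b ¬ab =
    byCover (cover a ua) (cover b ub)
    where
    ua : Adj G u a
    ua = Graph.sym G au

    a#b : Apart a b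
    a#b = a≢b , ¬ab

    u#x : Apart u x
    u#x = (λ { refl → ¬yu (Graph.sym G xy) }) , (λ ux → ¬xu (Graph.sym G ux))

    u#y : Apart u y
    u#y = (λ { refl → ¬xu xy }) , (λ uy → ¬yu (Graph.sym G uy))

    neighbour-≢ : ∀ {c w} → Adj G u c → Apart u w → c ≢ w
    neighbour-≢ uc (_ , ¬uw) refl = ¬uw uc

    viaEdge : ∀ {w z} → Apart u w → Apart u z → Adj G w z → Adj G a w → Adj G b z →
              P3InInducedCycle G a u b
    viaEdge {w} {z} u#w u#z wz aw bz with adj? G a z | adj? G b w
    ... | yes az | _      = p3InInducedC4 ua ub a#b az (Graph.sym G bz) u#z
    ... | no _   | yes bw = p3InInducedC4 ua ub a#b aw (Graph.sym G bw) u#w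
    ... | no ¬az | no ¬bw =
      p3InInducedC5 ua ub a#b aw wz (Graph.sym G bz)
        (neighbour-≢ ua u#z , ¬az)
        (apart-sym (neighbour-≢ ub u#w , ¬bw))
        u#w u#z

    byCover : Adj G a x ⊎ Adj G a y → Adj G b x ⊎ Adj G b y → P3InInducedCycle G a u b
    byCover (inj₁ ax) (inj₁ bx) = p3InInducedC4 ua ub a#b ax (Graph.sym G bx) u#x
    byCover (inj₂ ay) (inj₂ by) = p3InInducedC4 ua ub a#b ay (Graph.sym G by) u#y
    byCover (inj₁ ax) (inj₂ by) = viaEdge u#x u#y xy ax by
    byCover (inj₂ ay) (inj₁ bx) = viaEdge u#y u#x (Graph.sym G xy) ay bx

adj⇒apart-complement : ∀ {n} (G : Graph n) {a b} → Adj G a b → Apart (complement G) a b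
adj⇒apart-complement G ab = adj⇒≢ G ab , λ (_ , ¬ab) → ¬ab ab

¬adj-complement⇒adj : ∀ {n} (G : Graph n) {a b} → a ≢ b → ¬ Adj (complement G) a b → Adj G a b
¬adj-complement⇒adj G a≢b ¬ab = decidable-stable (adj? G _ _) (λ ¬ab′ → ¬ab (a≢b , ¬ab′))

commonNonNeighbour⇒p3InComplement : ∀ {n} (G : Graph n) {u x y a} →
  Adj (complement G) x u → Adj (complement G) u y → Apart (complement G) x y →
  Adj G u a → ¬ Adj G a x → ¬ Adj G a y → P3InInducedCycle (complement G) x u y
commonNonNeighbour⇒p3InComplement G xu uy x#y ua ¬ax ¬ay =
  p3InInducedC4 (complement G) (Graph.sym (complement G) xu) uy x#y
    ((λ { refl → proj₂ xu (Graph.sym G ua) }) , λ xa → ¬ax (Graph.sym G xa))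
    ((λ { refl → proj₂ uy ua }) , ¬ay)
    (adj⇒apart-complement G ua)

lemma7 : ∀ {n} (G : Graph n) (u : Fin n) → ¬ Avoidable G u → Avoidable (complement G) u
lemma7 G u ¬avoidable x y xu uy x≢y ¬xy
  with any? (λ a → adj? G u a ×-dec ¬? (adj? G a x) ×-dec ¬? (adj? G a y))
... | yes (a , ua , ¬ax , ¬ay) = commonNonNeighbour⇒p3InComplement G xu uy (x≢y , ¬xy) ua ¬ax ¬ay
... | no ∄a = ⊥-elim (¬avoidable (dominatingEdge⇒avoidable G
                (¬adj-complement⇒adj G x≢y ¬xy) (proj₂ xu) (λ yu → proj₂ uy (Graph.sym G yu)) cover))
  where
  cover : ∀ a → Adj G u a → Adj G a x ⊎ Adj G a y
  cover a ua with adj? G a x | adj? G a y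
  ... | yes ax | _      = inj₁ ax
  ... | no _   | yes ay = inj₂ ay
  ... | no ¬ax | no ¬ay = ⊥-elim (∄a (a , ua , ¬ax , ¬ay))
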